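{- Let $v$ be an RGF and let $\bar v=1(v+1)$. Then for every integer $n\ge 1$, $$\mathrm{LS}_n(\bar v)=\sum_{j=0}^{n-1}\binom{n-1}{j}q^j\,\mathrm{LS}_j(v)$$ and $$\mathrm{RS}_n(\bar v)=\sum_{j=0}^{n-1}\sum_{k=0}^{j}\binom{n+k-j-2}{k}q^k\,\mathrm{RS}_j(v).$$
   Context: A restricted growth function (RGF) of length $n$ is a sequence $w=w_1\dots w_n$ of positive integers with $w_1=1$ and $w_i\le 1+\max\{w_1,\dots,w_{i-1}\}$ for $i\ge 2$; $R_0$ consists of the empty word and $R_n$ is the set of RGFs of length $n$. For a word $w$ and integer $k\ge 0$, $w+k$ is obtained by adding $k$ to every letter of $w$, and $1(v+1)$ denotes the concatenation of the letter $1$ with $v+1$. The standardization of a word replaces every occurrence of its smallest letter by $1$, of its next smallest letter by $2$, and so on. An RGF $w$ contains an RGF $v$ if some subword (subsequence, not necessarily consecutive) of $w$ standardizes to $v$; otherwise $w$ avoids $v$. $R_n(v)$ is the set of $w\in R_n$ avoiding $v$. For a word $w$ and position $j$: $\mathrm{ls}(w_j)$ is the number of distinct values $w_i$ with $i<j$ and $w_i<w_j$; $\mathrm{rs}(w_j)$ is the number of distinct values $w_i$ with $i>j$ and $w_i<w_j$; statistics of $w$ are sums over $j$. $\mathrm{LS}_n(v)=\sum_{w\in R_n(v)}q^{\mathrm{ls}(w)}$, $\mathrm{RS}_n(v)=\sum_{w\in R_n(v)}q^{\mathrm{rs}(w)}$. Binomial convention: $\binom{a}{0}=1$ for all integers $a\ge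 -1$, and $\binom{a}{k}=0$ if $0\le a<k$. -}

module Defs where

open import Data.Bool using (Bool; true; false; _∧_; if_then_else_)
open import Data.Nat using (ℕ; zero; suc; _+_; _*_; _∸_; _≤ᵇ_; _<ᵇ_; _≡ᵇ_; _⊔_)
open import Data.Nat.Combinatorics using (_C_)
open import Data.Bool.ListAction using (any)
open import Data.Integer using (ℤ; +_; -[1+_])
open import Data.List using (List; []; _∷_; _++_; [_]; map; length; filterᵇ; deduplicateᵇ; upTo; concatMap; and; zipWith)

Word : Set
Word = List ℕ

_==w_ : Word → Word → Bool
[] ==w [] = true
[] ==w (_ ∷ _) = false
(_ ∷ _) ==w [] = false
(x ∷ xs) ==w (y ∷ ys) = (x ≡ᵇ y) ∧ (xs ==w ys)

isRGFFrom : ℕ → Word → Bool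
isRGFFrom mx [] = true
isRGFFrom mx (x ∷ xs) = (1 ≤ᵇ x) ∧ (x ≤ᵇ suc mx) ∧ isRGFFrom (mx ⊔ x) xs

isRGF : Word → Bool
isRGF = isRGFFrom 0

allWords : ℕ → ℕ → List Word
allWords zero b = [ [] ]
allWords (suc n) b = concatMap (λ x → map (suc x ∷_) (allWords n b)) (upTo b)

-- R n : the RGFs of length n (every letter of an RGF of length n is ≤ n).
R : ℕ → List Word
R n = filterᵇ isRGF (allWords n n)

distinctBelow : Word → ℕ → ℕ
distinctBelow u x = length (deduplicateᵇ _≡ᵇ_ (filterᵇ (λ y → y <ᵇ x) u))

std : Word → Word
std u = map (λ x → suc (distinctBelow u x)) u

subwords : Word → List Word
subwords [] = [ [] ]
subwords (x ∷ xs) = map (x ∷_) (subwords xs) ++ subwords xs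

contains : Word → Word → Bool
contains w v = any (λ u → std u ==w v) (subwords w)

avoids : Word → Word → Bool
avoids w v = if contains w v then false else true

Rav : ℕ → Word → List Word
Rav n v = filterᵇ (λ w → avoids w v) (R n)

lsFrom : Word → Word → ℕ
lsFrom pre [] = 0
lsFrom pre (x ∷ xs) = distinctBelow pre x + lsFrom (pre ++ [ x ]) xs

ls : Word → ℕ
ls = lsFrom []

rs : Word → ℕ
rs [] = 0
rs (x ∷ xs) = distinctBelow xs x + rs xs

-- Polynomials in q with ℕ coefficients, as coefficient functions:
-- p m is the coefficient of q^m.
Poly : Set
Poly = ℕ → ℕ

qpow* : ℕ → Poly → Poly
qpow* j p m = if j ≤ᵇ m then p (m ∸ j) else 0

scale : ℕ → Poly → Poly
scale c p m = c * p m

Σ< : ℕ → (ℕ → Poly) → Poly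
Σ< zero f m = 0
Σ< (suc n) f m = Σ< n f m + f n m

Σ≤ : ℕ → (ℕ → Poly) → Poly
Σ≤ n = Σ< (suc n)

genFun : (Word → ℕ) → ℕ → Word → Poly
genFun st n v m = length (filterᵇ (λ w → st w ≡ᵇ m) (Rav n v))

LS : ℕ → Word → Poly
LS = genFun ls

RS : ℕ → Word → Poly
RS = genFun rs

-- binomial coefficient with integer top: C(a,0)=1 for a ≥ -1, C(-1,k)=0 for k ≥ 1
-- (only a ≥ -1 arises), C(a,k) = a C k for a ≥ 0.
binomℤ : ℤ → ℕ → ℕ
binomℤ (+ a) k = a C k
binomℤ -[1+ _ ] zero = 1
binomℤ -[1+ _ ] (suc k) = 0

bar : Word → Word
bar v = 1 ∷ map suc v

module Submission where

-- Write w ∈ R_{n+1} as 1t. Recording which letters of t exceed 1 gives a bit list p of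
-- length n, and deleting the 1s of t and lowering its other letters by one gives an RGF u
-- of length #trues(p); the map t ↦ (p, u) is a bijection. Moreover 1t avoids 1(v+1) iff
-- u avoids v, ls(1t) = #trues(p) + ls(u), and rs(1t) = e(p) + rs(u), where e(p) counts
-- the trues followed by some false. Hence both generating functions are sums over bit
-- lists p of q^{#trues(p)} LS_{#trues(p)}(v), resp. q^{e(p)} RS_{#trues(p)}(v), and it
-- remains to count bit lists: C(n, j) of them have j trues, and among these
-- C(n - j + k - 1, k) have e(p) = k (peel off the last letter).

open import Defs
open import Data.Bool using (Bool; true; false; T; T?; _∧_; _∨_; not; if_then_else_)
open import Data.Bool.Properties using (T-≡; T-∧; ∧-comm)
open import Data.Empty using (⊥-elim)
open import Data.List using (List; []; _∷_; _++_; [_]; map; length; concat; applyUpTo; filter; filterᵇ; deduplicateᵇ)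
open import Data.List.Properties using (map-∘; map-++; map-cong; map-cong-local; map-injective; ∷-injective; ++-identityʳ)
open import Data.List.Relation.Binary.Sublist.Propositional using (_⊆_; []; _∷_; _∷ʳ_)
open import Data.List.Relation.Binary.Sublist.Propositional.Properties using (∷⁻; All-resp-⊆)
open import Data.List.Relation.Unary.All as All using (All; []; _∷_)
import Data.List.Relation.Unary.All.Properties as All
open import Data.List.Relation.Unary.Any using (Any; here)
import Data.List.Relation.Unary.Any.Properties as Any
open import Data.Nat using (ℕ; zero; suc; pred; _+_; _*_; _∸_; _≤_; _<_; _≥_; z≤n; s≤s; z<s; s<s; _≤ᵇ_; _<ᵇ_; _≡ᵇ_; _⊔_)
open import Data.Nat.Combinatorics using (_C_; nCk+nC[k+1]≡[n+1]C[k+1]; k>n⇒nCk≡0)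
open import Data.Nat.ListAction using (sum)
open import Data.Nat.ListAction.Properties using (sum-++)
open import Data.Nat.Properties
open import Data.Nat.Solver using (module +-*-Solver)
open import Data.Product using (∃-syntax; _×_; _,_; proj₁; proj₂)
open import Data.Sum using (inj₁; inj₂)
open import Function using (_∘_; id)
open import Function.Bundles using (Equivalence)
open import Relation.Nullary using (¬_; ¬?; yes; no)
open import Relation.Binary.PropositionalEquality using (_≡_; _≢_; ≢-sym; refl; sym; trans; cong; cong₂; subst; module ≡-Reasoning)
open import Algebra.Properties.CommutativeSemigroup +-commutativeSemigroup using (interchange; x∙yz≈y∙xz)

open +-*-Solver using (solve; _:+_; _:=_; con)
open ≡-Reasoning

𝟙 : Bool → ℕ
𝟙 true = 1
𝟙 false = 0

T⇒≡true : ∀ {b} → T b → b ≡ true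
T⇒≡true = Equivalence.to T-≡

¬T⇒≡false : ∀ {b} → ¬ T b → b ≡ false
¬T⇒≡false {false} _ = refl
¬T⇒≡false {true} ¬t = ⊥-elim (¬t _)

T-ext : ∀ {a b} → (T a → T b) → (T b → T a) → a ≡ b
T-ext {true} {true} _ _ = refl
T-ext {true} {false} a⇒b _ = ⊥-elim (a⇒b _)
T-ext {false} {true} _ b⇒a = ⊥-elim (b⇒a _)
T-ext {false} {false} _ _ = refl

≡ᵇ-refl : ∀ n → (n ≡ᵇ n) ≡ true
≡ᵇ-refl n = T⇒≡true (≡⇒≡ᵇ n n refl)

≡ᵇ≡true⇒≡ : ∀ {m n} → (m ≡ᵇ n) ≡ true → m ≡ n
≡ᵇ≡true⇒≡ {m} {n} e = ≡ᵇ⇒≡ m n (Equivalence.from T-≡ e)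

≢⇒≡ᵇ≡false : ∀ {m n} → m ≢ n → (m ≡ᵇ n) ≡ false
≢⇒≡ᵇ≡false {m} {n} m≢n = ¬T⇒≡false (m≢n ∘ ≡ᵇ⇒≡ m n)

-- Finite sums and sums over bit patterns

sum< : ℕ → (ℕ → ℕ) → ℕ
sum< zero f = 0
sum< (suc n) f = f 0 + sum< n (f ∘ suc)

sum<-cong : ∀ n {f g : ℕ → ℕ} → (∀ i → i < n → f i ≡ g i) → sum< n f ≡ sum< n g
sum<-cong zero f≡g = refl
sum<-cong (suc n) f≡g = cong₂ _+_ (f≡g 0 z<s) (sum<-cong n (λ i i<n → f≡g (suc i) (s<s i<n)))

sum<-suc : ∀ n f → sum< (suc n) f ≡ sum< n f + f n
sum<-suc zero f = +-comm (f 0) 0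
sum<-suc (suc n) f = trans (cong (f 0 +_) (sum<-suc n (f ∘ suc))) (sym (+-assoc (f 0) _ _))

sum<-+ : ∀ n f g → sum< n (λ i → f i + g i) ≡ sum< n f + sum< n g
sum<-+ zero f g = refl
sum<-+ (suc n) f g =
  trans (cong ((f 0 + g 0) +_) (sum<-+ n (f ∘ suc) (g ∘ suc))) (interchange (f 0) (g 0) _ _)

sum<-0 : ∀ n → sum< n (λ _ → 0) ≡ 0
sum<-0 zero = refl
sum<-0 (suc n) = sum<-0 n

sum<-split : ∀ a c f → sum< (a + c) f ≡ sum< a f + sum< c (λ i → f (a + i))
sum<-split zero c f = refl
sum<-split (suc a) c f =
  trans (cong (f 0 +_) (sum<-split a c (f ∘ suc))) (sym (+-assoc (f 0) _ _))

sumBits : ℕ → (List Bool → ℕ) → ℕ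
sumBits zero f = f []
sumBits (suc n) f = sumBits n (f ∘ (false ∷_)) + sumBits n (f ∘ (true ∷_))

sumBits-cong : ∀ n {f g : List Bool → ℕ} → (∀ p → f p ≡ g p) → sumBits n f ≡ sumBits n g
sumBits-cong zero f≡g = f≡g []
sumBits-cong (suc n) f≡g =
  cong₂ _+_ (sumBits-cong n (f≡g ∘ (false ∷_))) (sumBits-cong n (f≡g ∘ (true ∷_)))

sum<-sumBits : ∀ m n (f : ℕ → List Bool → ℕ) →
  sum< m (λ y → sumBits n (f y)) ≡ sumBits n (λ p → sum< m (λ y → f y p))
sum<-sumBits m zero f = refl
sum<-sumBits m (suc n) f =
  trans (sum<-+ m _ _) (cong₂ _+_ (sum<-sumBits m n _) (sum<-sumBits m n _))

sumBits-snoc : ∀ n f →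
  sumBits (suc n) f ≡ sumBits n (λ p → f (p ++ [ false ])) + sumBits n (λ p → f (p ++ [ true ]))
sumBits-snoc zero f = refl
sumBits-snoc (suc n) f =
  trans (cong₂ _+_ (sumBits-snoc n (f ∘ (false ∷_))) (sumBits-snoc n (f ∘ (true ∷_))))
        (interchange (sumBits n (λ p → f (false ∷ p ++ [ false ]))) _ _ _)

trues : List Bool → ℕ
trues [] = 0
trues (false ∷ p) = trues p
trues (true ∷ p) = suc (trues p)

hasFalse : List Bool → Bool
hasFalse [] = false
hasFalse (false ∷ p) = true
hasFalse (true ∷ p) = hasFalse p

truesBeforeFalse : List Bool → ℕ
truesBeforeFalse [] = 0
truesBeforeFalse (false ∷ p) = truesBeforeFalse p
truesBeforeFalse (true ∷ p) = 𝟙 (hasFalse p) + truesBeforeFalse p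

trues-snoc-false : ∀ p → trues (p ++ [ false ]) ≡ trues p
trues-snoc-false [] = refl
trues-snoc-false (false ∷ p) = trues-snoc-false p
trues-snoc-false (true ∷ p) = cong suc (trues-snoc-false p)

trues-snoc-true : ∀ p → trues (p ++ [ true ]) ≡ suc (trues p)
trues-snoc-true [] = refl
trues-snoc-true (false ∷ p) = trues-snoc-true p
trues-snoc-true (true ∷ p) = cong suc (trues-snoc-true p)

hasFalse-snoc-false : ∀ p → hasFalse (p ++ [ false ]) ≡ true
hasFalse-snoc-false [] = refl
hasFalse-snoc-false (false ∷ p) = refl
hasFalse-snoc-false (true ∷ p) = hasFalse-snoc-false p

hasFalse-snoc-true : ∀ p → hasFalse (p ++ [ true ]) ≡ hasFalse p
hasFalse-snoc-true [] = refl
hasFalse-snoc-true (false ∷ p) = refl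
hasFalse-snoc-true (true ∷ p) = hasFalse-snoc-true p

truesBeforeFalse-snoc-false : ∀ p → truesBeforeFalse (p ++ [ false ]) ≡ trues p
truesBeforeFalse-snoc-false [] = refl
truesBeforeFalse-snoc-false (false ∷ p) = truesBeforeFalse-snoc-false p
truesBeforeFalse-snoc-false (true ∷ p) =
  cong₂ _+_ (cong 𝟙 (hasFalse-snoc-false p)) (truesBeforeFalse-snoc-false p)

truesBeforeFalse-snoc-true : ∀ p → truesBeforeFalse (p ++ [ true ]) ≡ truesBeforeFalse p
truesBeforeFalse-snoc-true [] = refl
truesBeforeFalse-snoc-true (false ∷ p) = truesBeforeFalse-snoc-true p
truesBeforeFalse-snoc-true (true ∷ p) =
  cong₂ _+_ (cong 𝟙 (hasFalse-snoc-true p)) (truesBeforeFalse-snoc-true p)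

sumBits-trues : ∀ n (g : ℕ → ℕ) → sumBits n (g ∘ trues) ≡ sum< (suc n) (λ j → (n C j) * g j)
sumBits-trues zero g = sym (trans (+-identityʳ ((0 C 0) * g 0)) (*-identityˡ (g 0)))
sumBits-trues (suc n) g = begin
  sumBits n (g ∘ trues) + sumBits n (g ∘ suc ∘ trues)
    ≡⟨ cong₂ _+_ (sumBits-trues n g) (sumBits-trues n (g ∘ suc)) ⟩
  (g 0 + 0 + X) + Y
    ≡⟨ rearrange (g 0 + 0) X Y ⟩
  g 0 + 0 + (Y + (X + 0))
    ≡⟨ cong (g 0 + 0 +_) (sym pascal) ⟩
  sum< (suc (suc n)) (λ j → (suc n C j) * g j) ∎
  where
  X = sum< n (λ j → (n C suc j) * g (suc j))
  Y = sum< (suc n) (λ j → (n C j) * g (suc j))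
  rearrange : ∀ a x y → (a + x) + y ≡ a + (y + (x + 0))
  rearrange = solve 3 (λ a x y → (a :+ x) :+ y := a :+ (y :+ (x :+ con 0))) refl
  pascal : sum< (suc n) (λ j → (suc n C suc j) * g (suc j)) ≡ Y + (X + 0)
  pascal = begin
    sum< (suc n) (λ j → (suc n C suc j) * g (suc j))
      ≡⟨ sum<-cong (suc n) (λ j _ → cong (_* g (suc j)) (sym (nCk+nC[k+1]≡[n+1]C[k+1] n j))) ⟩
    sum< (suc n) (λ j → (n C j + n C suc j) * g (suc j))
      ≡⟨ sum<-cong (suc n) (λ j _ → *-distribʳ-+ (g (suc j)) (n C j) (n C suc j)) ⟩
    sum< (suc n) (λ j → (n C j) * g (suc j) + (n C suc j) * g (suc j))
      ≡⟨ sum<-+ (suc n) (λ j → (n C j) * g (suc j)) (λ j → (n C suc j) * g (suc j)) ⟩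
    Y + sum< (suc n) (λ j → (n C suc j) * g (suc j))
      ≡⟨ cong (Y +_) (sum<-suc n _) ⟩
    Y + (X + (n C suc n) * g (suc n))
      ≡⟨ cong (λ c → Y + (X + c * g (suc n))) (k>n⇒nCk≡0 {n} {suc n} ≤-refl) ⟩
    Y + (X + 0) ∎

-- The number of multisets of size k drawn from a elements, i.e. C(a + k - 1, k).
multichoose : ℕ → ℕ → ℕ
multichoose zero zero = 1
multichoose zero (suc k) = 0
multichoose (suc a) k = (a + k) C k

multichoose-∸ : ∀ n j → j < n → multichoose (n ∸ j) (suc j) ≡ n C suc j
multichoose-∸ n j j<n = begin
  multichoose (n ∸ j) (suc j)       ≡⟨ cong (λ a → multichoose a (suc j)) (+-∸-assoc 1 j<n) ⟩
  (n ∸ suc j + suc j) C suc j       ≡⟨ cong (_C suc j) (m∸n+n≡m j<n) ⟩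
  n C suc j                         ∎

sumMultichoose : ℕ → (ℕ → ℕ → ℕ) → ℕ
sumMultichoose n G = sum< (suc n) (λ j → sum< (suc j) (λ k → multichoose (n ∸ j) k * G j k))

sumMultichoose-suc : ∀ n G →
  sumMultichoose (suc n) G ≡ sum< (suc n) (λ j → (n C j) * G j j) + sumMultichoose n (G ∘ suc)
sumMultichoose-suc n G = begin
  sum< (suc (suc n)) (λ j → sum< (suc j) (λ k → multichoose (suc n ∸ j) k * G j k))
    ≡⟨ cong₂ _+_ (+-identityʳ G00) (sum<-cong (suc n) (λ j _ → sum<-suc (suc j) (F j))) ⟩
  G00 + sum< (suc n) (λ j → sum< (suc j) (F j) + E j)
    ≡⟨ cong (G00 +_) (sum<-+ (suc n) (λ j → sum< (suc j) (F j)) E) ⟩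
  G00 + (D + sum< (suc n) E)
    ≡⟨ cong (λ z → G00 + (D + z)) lastColumn ⟩
  G00 + (D + (X + 0))
    ≡⟨ rearrange G00 D X ⟩
  (G00 + X) + D ∎
  where
  G00 = multichoose (suc n) 0 * G 0 0
  F : ℕ → ℕ → ℕ
  F j k = multichoose (n ∸ j) k * G (suc j) k
  D = sumMultichoose n (G ∘ suc)
  E : ℕ → ℕ
  E j = multichoose (n ∸ j) (suc j) * G (suc j) (suc j)
  X = sum< n (λ j → (n C suc j) * G (suc j) (suc j))
  rearrange : ∀ a d x → a + (d + (x + 0)) ≡ (a + x) + d
  rearrange = solve 3 (λ a d x → a :+ (d :+ (x :+ con 0)) := (a :+ x) :+ d) refl
  lastColumn : sum< (suc n) E ≡ X + 0
  lastColumn = begin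
    sum< (suc n) E
      ≡⟨ sum<-suc n E ⟩
    sum< n E + E n
      ≡⟨ cong₂ _+_ (sum<-cong n (λ j j<n → cong (_* G (suc j) (suc j)) (multichoose-∸ n j j<n)))
                   (cong (λ a → multichoose a (suc n) * G (suc n) (suc n)) (n∸n≡0 n)) ⟩
    X + 0 ∎

-- A pattern of length n + 1 ends either in a false, after which all its trues count,
-- or in a true, which does not count.
sumBits-trues-truesBeforeFalse : ∀ n (G : ℕ → ℕ → ℕ) →
  sumBits n (λ p → G (trues p) (truesBeforeFalse p)) ≡ sumMultichoose n G
sumBits-trues-truesBeforeFalse zero G =
  sym (trans (+-identityʳ _) (trans (+-identityʳ (1 * G 0 0)) (*-identityˡ (G 0 0))))
sumBits-trues-truesBeforeFalse (suc n) G = begin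
  sumBits (suc n) (λ p → G (trues p) (truesBeforeFalse p))
    ≡⟨ sumBits-snoc n (λ p → G (trues p) (truesBeforeFalse p)) ⟩
  sumBits n (λ p → G (trues (p ++ [ false ])) (truesBeforeFalse (p ++ [ false ])))
    + sumBits n (λ p → G (trues (p ++ [ true ])) (truesBeforeFalse (p ++ [ true ])))
    ≡⟨ cong₂ _+_ (sumBits-cong n (λ p → cong₂ G (trues-snoc-false p) (truesBeforeFalse-snoc-false p)))
                 (sumBits-cong n (λ p → cong₂ G (trues-snoc-true p) (truesBeforeFalse-snoc-true p))) ⟩
  sumBits n (λ p → G (trues p) (trues p)) + sumBits n (λ p → G (suc (trues p)) (truesBeforeFalse p))
    ≡⟨ cong₂ _+_ (sumBits-trues n (λ j → G j j)) (sumBits-trues-truesBeforeFalse n (G ∘ suc)) ⟩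
  sum< (suc n) (λ j → (n C j) * G j j) + sumMultichoose n (G ∘ suc)
    ≡⟨ sumMultichoose-suc n G ⟨
  sumMultichoose (suc n) G ∎

-- Enumerating restricted growth functions

sum-map-++ : ∀ (f : Word → ℕ) l l' → sum (map f (l ++ l')) ≡ sum (map f l) + sum (map f l')
sum-map-++ f l l' = trans (cong sum (map-++ f l l')) (sum-++ (map f l) (map f l'))

sum-map-0 : ∀ {f : Word → ℕ} l → (∀ w → f w ≡ 0) → sum (map f l) ≡ 0
sum-map-0 [] f≡0 = refl
sum-map-0 (w ∷ l) f≡0 = cong₂ _+_ (f≡0 w) (sum-map-0 l f≡0)

sum-map-filterᵇ : ∀ (f : Word → ℕ) p l → sum (map f (filterᵇ p l)) ≡ sum (map (λ w → 𝟙 (p w) * f w) l)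
sum-map-filterᵇ f p [] = refl
sum-map-filterᵇ f p (w ∷ l) with p w
... | true = cong₂ _+_ (sym (+-identityʳ (f w))) (sum-map-filterᵇ f p l)
... | false = sum-map-filterᵇ f p l

length-filterᵇ : ∀ p (l : List Word) → length (filterᵇ p l) ≡ sum (map (𝟙 ∘ p) l)
length-filterᵇ p [] = refl
length-filterᵇ p (w ∷ l) with p w
... | true = cong suc (length-filterᵇ p l)
... | false = length-filterᵇ p l

sum-concat-applyUpTo : ∀ b (g : ℕ → ℕ) (h : ℕ → List Word) (f : Word → ℕ) →
  sum (map f (concat (map h (applyUpTo g b)))) ≡ sum< b (λ x → sum (map f (h (g x))))
sum-concat-applyUpTo zero g h f = refl
sum-concat-applyUpTo (suc b) g h f =
  trans (sum-map-++ f (h (g 0)) _) (cong (sum (map f (h (g 0))) +_) (sum-concat-applyUpTo b (g ∘ suc) h f))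

sum-allWords-suc : ∀ n b (f : Word → ℕ) →
  sum (map f (allWords (suc n) b)) ≡ sum< b (λ x → sum (map (f ∘ (suc x ∷_)) (allWords n b)))
sum-allWords-suc n b f =
  trans (sum-concat-applyUpTo b id (λ x → map (suc x ∷_) (allWords n b)) f)
        (sum<-cong b (λ x _ → cong sum (sym (map-∘ (allWords n b)))))

-- sumRGF n mx F sums F over the words t of length n such that u t is an RGF,
-- for any RGF u with largest letter mx.
sumRGF : ℕ → ℕ → (Word → ℕ) → ℕ
sumRGF zero mx F = F []
sumRGF (suc n) mx F = sum< (suc mx) (λ x → sumRGF n (mx ⊔ suc x) (F ∘ (suc x ∷_)))

sum-allWords-isRGFFrom : ∀ n mx b F → mx + n ≤ b →
  sum (map (λ w → 𝟙 (isRGFFrom mx w) * F w) (allWords n b)) ≡ sumRGF n mx F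
sum-allWords-isRGFFrom zero mx b F _ = trans (+-identityʳ _) (*-identityˡ (F []))
sum-allWords-isRGFFrom (suc n) mx b F fits = begin
  sum (map (λ w → 𝟙 (isRGFFrom mx w) * F w) (allWords (suc n) b))
    ≡⟨ sum-allWords-suc n b _ ⟩
  sum< b h
    ≡⟨ cong (λ z → sum< z h) (m+[n∸m]≡n (m+n≤o⇒m≤o (suc mx) fits′)) ⟨
  sum< (suc mx + (b ∸ suc mx)) h
    ≡⟨ sum<-split (suc mx) (b ∸ suc mx) h ⟩
  sum< (suc mx) h + sum< (b ∸ suc mx) (λ i → h (suc mx + i))
    ≡⟨ cong₂ _+_ (sum<-cong (suc mx) allowed)
                 (trans (sum<-cong (b ∸ suc mx) (λ i _ → tooLarge i)) (sum<-0 (b ∸ suc mx))) ⟩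
  sumRGF (suc n) mx F + 0
    ≡⟨ +-identityʳ _ ⟩
  sumRGF (suc n) mx F ∎
  where
  fits′ : suc mx + n ≤ b
  fits′ = ≤-trans (≤-reflexive (sym (+-suc mx n))) fits
  h : ℕ → ℕ
  h x = sum (map (λ w → 𝟙 (isRGFFrom mx (suc x ∷ w)) * F (suc x ∷ w)) (allWords n b))
  allowed : ∀ x → x < suc mx → h x ≡ sumRGF n (mx ⊔ suc x) (F ∘ (suc x ∷_))
  allowed x x≤mx = trans
    (cong sum (map-cong (λ w → cong (λ z → 𝟙 (z ∧ isRGFFrom (mx ⊔ suc x) w) * F (suc x ∷ w))
                                    (T⇒≡true (<⇒<ᵇ x≤mx)))
                        (allWords n b)))
    (sum-allWords-isRGFFrom n (mx ⊔ suc x) b (F ∘ (suc x ∷_))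
                            (≤-trans (+-monoˡ-≤ n (⊔-lub (n≤1+n mx) x≤mx)) fits′))
  tooLarge : ∀ i → h (suc mx + i) ≡ 0
  tooLarge i = sum-map-0 (allWords n b) (λ w →
    cong (λ z → 𝟙 (z ∧ isRGFFrom (mx ⊔ suc (suc mx + i)) w) * F (suc (suc mx + i) ∷ w))
         (¬T⇒≡false (λ x<mx → <-irrefl refl (≤-trans (<ᵇ⇒< _ _ x<mx) (s≤s (m≤m+n mx i))))))

genFun≡sumRGF : ∀ st n v m → genFun st n v m ≡ sumRGF n 0 (λ w → 𝟙 (avoids w v) * 𝟙 (st w ≡ᵇ m))
genFun≡sumRGF st n v m = begin
  length (filterᵇ (λ w → st w ≡ᵇ m) (Rav n v))
    ≡⟨ length-filterᵇ _ (Rav n v) ⟩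
  sum (map (λ w → 𝟙 (st w ≡ᵇ m)) (Rav n v))
    ≡⟨ sum-map-filterᵇ _ (λ w → avoids w v) (R n) ⟩
  sum (map (λ w → 𝟙 (avoids w v) * 𝟙 (st w ≡ᵇ m)) (R n))
    ≡⟨ sum-map-filterᵇ _ isRGF (allWords n n) ⟩
  sum (map (λ w → 𝟙 (isRGF w) * (𝟙 (avoids w v) * 𝟙 (st w ≡ᵇ m))) (allWords n n))
    ≡⟨ sum-allWords-isRGFFrom n 0 n _ ≤-refl ⟩
  sumRGF n 0 (λ w → 𝟙 (avoids w v) * 𝟙 (st w ≡ᵇ m)) ∎

Positive : Word → Set
Positive = All (0 <_)

sumRGF-cong : ∀ n mx {F G : Word → ℕ} → (∀ w → Positive w → F w ≡ G w) → sumRGF n mx F ≡ sumRGF n mx G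
sumRGF-cong zero mx F≡G = F≡G [] []
sumRGF-cong (suc n) mx F≡G =
  sum<-cong (suc mx) (λ x _ → sumRGF-cong n (mx ⊔ suc x) (λ w w⁺ → F≡G (suc x ∷ w) (z<s ∷ w⁺)))

sumRGF-0 : ∀ n mx → sumRGF n mx (λ _ → 0) ≡ 0
sumRGF-0 zero mx = refl
sumRGF-0 (suc n) mx = trans (sum<-cong (suc mx) (λ x _ → sumRGF-0 n (mx ⊔ suc x))) (sum<-0 (suc mx))

<ᵇ-suc : ∀ k m → (k <ᵇ suc m) ≡ (k ≤ᵇ m)
<ᵇ-suc zero m = refl
<ᵇ-suc (suc k) m = refl

genFun-shift : ∀ st j v k m →
  sumRGF j 0 (λ u → 𝟙 (avoids u v) * 𝟙 (k + st u ≡ᵇ m)) ≡ qpow* k (genFun st j v) m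
genFun-shift st j v zero m = sym (genFun≡sumRGF st j v m)
genFun-shift st j v (suc k) zero =
  trans (sumRGF-cong j 0 (λ u _ → *-zeroʳ (𝟙 (avoids u v)))) (sumRGF-0 j 0)
genFun-shift st j v (suc k) (suc m) =
  trans (genFun-shift st j v k m)
        (cong (λ b → if b then genFun st j v (m ∸ k) else 0) (sym (<ᵇ-suc k m)))

mask : Word → List Bool
mask [] = []
mask (zero ∷ t) = false ∷ mask t
mask (suc zero ∷ t) = false ∷ mask t
mask (suc (suc _) ∷ t) = true ∷ mask t

strip : Word → Word
strip [] = []
strip (zero ∷ t) = strip t
strip (suc zero ∷ t) = strip t
strip (suc (suc y) ∷ t) = suc y ∷ strip t

-- After a prefix containing the letter 1, the RGF continuations t correspond
-- bijectively to the pairs (mask t, strip t) with strip t an RGF continuation.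
sumRGF-mask-strip : ∀ n k (A : List Bool → Word → ℕ) →
  sumRGF n (suc k) (λ t → A (mask t) (strip t)) ≡ sumBits n (λ p → sumRGF (trues p) k (A p))
sumRGF-mask-strip zero k A = refl
sumRGF-mask-strip (suc n) k A = cong₂ _+_ nextIsOne nextIsLarger
  where
  nextIsOne : sumRGF n (suc k ⊔ 1) (λ w → A (false ∷ mask w) (strip w))
            ≡ sumBits n (λ p → sumRGF (trues p) k (A (false ∷ p)))
  nextIsOne = trans (cong (λ z → sumRGF n (suc z) (λ w → A (false ∷ mask w) (strip w))) (⊔-identityʳ k))
                    (sumRGF-mask-strip n k (A ∘ (false ∷_)))
  nextIsLarger : sum< (suc k) (λ y → sumRGF n (suc (k ⊔ suc y)) (λ w → A (true ∷ mask w) (suc y ∷ strip w)))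
               ≡ sumBits n (λ p → sumRGF (suc (trues p)) k (A (true ∷ p)))
  nextIsLarger =
    trans (sum<-cong (suc k) (λ y _ → sumRGF-mask-strip n (k ⊔ suc y) (λ p u → A (true ∷ p) (suc y ∷ u))))
          (sum<-sumBits (suc k) n (λ y p → sumRGF (trues p) (k ⊔ suc y) (λ u → A (true ∷ p) (suc y ∷ u))))

-- Counting distinct smaller letters

infix 4 _∈ᵇ_
_∈ᵇ_ : ℕ → Word → Bool
c ∈ᵇ [] = false
c ∈ᵇ (x ∷ xs) = (c ≡ᵇ x) ∨ (c ∈ᵇ xs)

countBelow : Word → ℕ → ℕ
countBelow u zero = 0
countBelow u (suc c) = countBelow u c + 𝟙 (c ∈ᵇ u)

nub : Word → Word
nub [] = []
nub (x ∷ xs) = x ∷ filterᵇ (λ y → not (x ≡ᵇ y)) (nub xs)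

filter-¬≡filterᵇ-not : ∀ (b : ℕ → Bool) l → filter (¬? ∘ T? ∘ b) l ≡ filterᵇ (not ∘ b) l
filter-¬≡filterᵇ-not b [] = refl
filter-¬≡filterᵇ-not b (y ∷ l) with b y
... | true = filter-¬≡filterᵇ-not b l
... | false = cong (y ∷_) (filter-¬≡filterᵇ-not b l)

deduplicateᵇ≡nub : ∀ l → deduplicateᵇ _≡ᵇ_ l ≡ nub l
deduplicateᵇ≡nub [] = refl
deduplicateᵇ≡nub (x ∷ l) = cong (x ∷_)
  (trans (filter-¬≡filterᵇ-not (x ≡ᵇ_) (deduplicateᵇ _≡ᵇ_ l))
         (cong (filterᵇ (λ y → not (x ≡ᵇ y))) (deduplicateᵇ≡nub l)))

filterᵇ-filterᵇ : ∀ (p q : ℕ → Bool) l → filterᵇ p (filterᵇ q l) ≡ filterᵇ (λ x → q x ∧ p x) l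
filterᵇ-filterᵇ p q [] = refl
filterᵇ-filterᵇ p q (x ∷ l) with q x
... | false = filterᵇ-filterᵇ p q l
... | true with p x
...   | true = cong (x ∷_) (filterᵇ-filterᵇ p q l)
...   | false = filterᵇ-filterᵇ p q l

filterᵇ-cong : ∀ {p q : ℕ → Bool} l → (∀ x → p x ≡ q x) → filterᵇ p l ≡ filterᵇ q l
filterᵇ-cong {p} {q} [] p≡q = refl
filterᵇ-cong {p} {q} (x ∷ l) p≡q with p x | q x | p≡q x
... | true | true | refl = cong (x ∷_) (filterᵇ-cong l p≡q)
... | false | false | refl = filterᵇ-cong l p≡q

filterᵇ-comm : ∀ (p q : ℕ → Bool) l → filterᵇ p (filterᵇ q l) ≡ filterᵇ q (filterᵇ p l)
filterᵇ-comm p q l = begin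
  filterᵇ p (filterᵇ q l)           ≡⟨ filterᵇ-filterᵇ p q l ⟩
  filterᵇ (λ x → q x ∧ p x) l       ≡⟨ filterᵇ-cong l (λ x → ∧-comm (q x) (p x)) ⟩
  filterᵇ (λ x → p x ∧ q x) l       ≡⟨ filterᵇ-filterᵇ q p l ⟨
  filterᵇ q (filterᵇ p l)           ∎

nub-filterᵇ : ∀ p l → nub (filterᵇ p l) ≡ filterᵇ p (nub l)
nub-filterᵇ p [] = refl
nub-filterᵇ p (x ∷ l) with p x in px
... | true = cong (x ∷_) (trans (cong (filterᵇ (λ y → not (x ≡ᵇ y))) (nub-filterᵇ p l))
                                (filterᵇ-comm (λ y → not (x ≡ᵇ y)) p (nub l)))
... | false = trans (nub-filterᵇ p l)
                    (sym (trans (filterᵇ-filterᵇ p (λ y → not (x ≡ᵇ y)) (nub l)) (filterᵇ-cong (nub l) dropsNothing)))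
  where
  dropsNothing : ∀ y → (not (x ≡ᵇ y) ∧ p y) ≡ p y
  dropsNothing y with x ≡ᵇ y in x≡y
  ... | true = trans (sym px) (cong p (≡ᵇ≡true⇒≡ x≡y))
  ... | false = refl

length-filterᵇ-partition : ∀ (p : ℕ → Bool) l →
  length l ≡ length (filterᵇ p l) + length (filterᵇ (not ∘ p) l)
length-filterᵇ-partition p [] = refl
length-filterᵇ-partition p (x ∷ l) with p x
... | true = cong suc (length-filterᵇ-partition p l)
... | false = trans (cong suc (length-filterᵇ-partition p l)) (sym (+-suc _ _))

∈ᵇ-filterᵇ : ∀ c (p : ℕ → Bool) l → p c ≡ true → (c ∈ᵇ filterᵇ p l) ≡ (c ∈ᵇ l)
∈ᵇ-filterᵇ c p [] pc = refl
∈ᵇ-filterᵇ c p (x ∷ l) pc with p x in px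
... | true = cong ((c ≡ᵇ x) ∨_) (∈ᵇ-filterᵇ c p l pc)
... | false with c ≡ᵇ x in c≡x
...   | true = ⊥-elim (subst T px (subst (T ∘ p) (≡ᵇ≡true⇒≡ c≡x) (subst T (sym pc) _)))
...   | false = ∈ᵇ-filterᵇ c p l pc

countBelow-cong : ∀ B {l l'} → (∀ c → c < B → (c ∈ᵇ l) ≡ (c ∈ᵇ l')) → countBelow l B ≡ countBelow l' B
countBelow-cong zero _ = refl
countBelow-cong (suc B) same = cong₂ _+_ (countBelow-cong B (λ c c<B → same c (m<n⇒m<1+n c<B))) (cong 𝟙 (same B ≤-refl))

filterᵇ-none : ∀ (p : ℕ → Bool) l → All (λ y → p y ≡ false) l → filterᵇ p l ≡ []
filterᵇ-none p [] [] = refl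
filterᵇ-none p (x ∷ l) (px ∷ pl) rewrite px = filterᵇ-none p l pl

length-nub-const : ∀ B l → All (_≡ B) l → length (nub l) ≡ 𝟙 (B ∈ᵇ l)
length-nub-const B [] [] = refl
length-nub-const B (x ∷ l) (refl ∷ l≡x) rewrite ≡ᵇ-refl x = cong suc (begin
  length (filterᵇ (λ y → not (x ≡ᵇ y)) (nub l))  ≡⟨ cong length (nub-filterᵇ (λ y → not (x ≡ᵇ y)) l) ⟨
  length (nub (filterᵇ (λ y → not (x ≡ᵇ y)) l))  ≡⟨ cong (length ∘ nub) (filterᵇ-none _ l (All.map dropped l≡x)) ⟩
  0                                              ∎)
  where
  dropped : ∀ {y} → y ≡ x → not (x ≡ᵇ y) ≡ false
  dropped refl = cong not (≡ᵇ-refl x)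

All-≡-filterᵇ-≡ᵇ : ∀ B l → All (_≡ B) (filterᵇ (_≡ᵇ B) l)
All-≡-filterᵇ-≡ᵇ B [] = []
All-≡-filterᵇ-≡ᵇ B (x ∷ l) with x ≡ᵇ B in x≡B
... | true = ≡ᵇ≡true⇒≡ x≡B ∷ All-≡-filterᵇ-≡ᵇ B l
... | false = All-≡-filterᵇ-≡ᵇ B l

All-<-filterᵇ-≢ : ∀ B l → All (_< suc B) l → All (_< B) (filterᵇ (λ y → not (y ≡ᵇ B)) l)
All-<-filterᵇ-≢ B [] [] = []
All-<-filterᵇ-≢ B (x ∷ l) (x<1+B ∷ l<1+B) with x ≡ᵇ B in x≡B
... | true = All-<-filterᵇ-≢ B l l<1+B
... | false = ≤∧≢⇒< (≤-pred x<1+B) (subst T x≡B ∘ ≡⇒≡ᵇ x B) ∷ All-<-filterᵇ-≢ B l l<1+B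

All-<-filterᵇ-<ᵇ : ∀ x l → All (_< x) (filterᵇ (_<ᵇ x) l)
All-<-filterᵇ-<ᵇ x [] = []
All-<-filterᵇ-<ᵇ x (y ∷ l) with y <ᵇ x in y<x
... | true = <ᵇ⇒< y x (subst T (sym y<x) _) ∷ All-<-filterᵇ-<ᵇ x l
... | false = All-<-filterᵇ-<ᵇ x l

-- Split off the occurrences of the largest possible letter B and recurse.
length-nub : ∀ B l → All (_< B) l → length (nub l) ≡ countBelow l B
length-nub zero [] [] = refl
length-nub zero (x ∷ l) (() ∷ _)
length-nub (suc B) l l<1+B = begin
  length (nub l)
    ≡⟨ length-filterᵇ-partition (_≡ᵇ B) (nub l) ⟩
  length (filterᵇ (_≡ᵇ B) (nub l)) + length (filterᵇ (λ y → not (y ≡ᵇ B)) (nub l))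
    ≡⟨ cong₂ _+_ (cong length (nub-filterᵇ (_≡ᵇ B) l)) (cong length (nub-filterᵇ (λ y → not (y ≡ᵇ B)) l)) ⟨
  length (nub (filterᵇ (_≡ᵇ B) l)) + length (nub (filterᵇ (λ y → not (y ≡ᵇ B)) l))
    ≡⟨ cong₂ _+_ (length-nub-const B _ (All-≡-filterᵇ-≡ᵇ B l)) (length-nub B _ (All-<-filterᵇ-≢ B l l<1+B)) ⟩
  𝟙 (B ∈ᵇ filterᵇ (_≡ᵇ B) l) + countBelow (filterᵇ (λ y → not (y ≡ᵇ B)) l) B
    ≡⟨ cong₂ _+_ (cong 𝟙 (∈ᵇ-filterᵇ B (_≡ᵇ B) l (≡ᵇ-refl B)))
                 (countBelow-cong B (λ c c<B →
                    ∈ᵇ-filterᵇ c _ l (cong not (¬T⇒≡false (<⇒≢ c<B ∘ ≡ᵇ⇒≡ c B))))) ⟩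
  𝟙 (B ∈ᵇ l) + countBelow l B
    ≡⟨ +-comm (𝟙 (B ∈ᵇ l)) (countBelow l B) ⟩
  countBelow l (suc B) ∎

distinctBelow≡countBelow : ∀ u x → distinctBelow u x ≡ countBelow u x
distinctBelow≡countBelow u x = begin
  length (deduplicateᵇ _≡ᵇ_ (filterᵇ (_<ᵇ x) u))  ≡⟨ cong length (deduplicateᵇ≡nub (filterᵇ (_<ᵇ x) u)) ⟩
  length (nub (filterᵇ (_<ᵇ x) u))                ≡⟨ length-nub x _ (All-<-filterᵇ-<ᵇ x u) ⟩
  countBelow (filterᵇ (_<ᵇ x) u) x               ≡⟨ countBelow-cong x (λ c c<x →
                                                      ∈ᵇ-filterᵇ c (_<ᵇ x) u (T⇒≡true (<⇒<ᵇ c<x))) ⟩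
  countBelow u x                                  ∎

-- The statistics ls and rs of 1 t

∈ᵇ-map-suc : ∀ c l → (suc c ∈ᵇ map suc l) ≡ (c ∈ᵇ l)
∈ᵇ-map-suc c [] = refl
∈ᵇ-map-suc c (x ∷ l) = cong ((c ≡ᵇ x) ∨_) (∈ᵇ-map-suc c l)

0∈ᵇ-map-suc : ∀ l → (0 ∈ᵇ map suc l) ≡ false
0∈ᵇ-map-suc [] = refl
0∈ᵇ-map-suc (x ∷ l) = 0∈ᵇ-map-suc l

countBelow-map-suc : ∀ l x → countBelow (map suc l) (suc x) ≡ countBelow l x
countBelow-map-suc l zero = cong 𝟙 (0∈ᵇ-map-suc l)
countBelow-map-suc l (suc x) = cong₂ _+_ (countBelow-map-suc l x) (cong 𝟙 (∈ᵇ-map-suc x l))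

0∈ᵇ-positive : ∀ {l} → Positive l → (0 ∈ᵇ l) ≡ false
0∈ᵇ-positive [] = refl
0∈ᵇ-positive {suc _ ∷ _} (_ ∷ l⁺) = 0∈ᵇ-positive l⁺

countBelow-1-positive : ∀ {l} → Positive l → countBelow l 1 ≡ 0
countBelow-1-positive l⁺ = cong 𝟙 (0∈ᵇ-positive l⁺)

∈ᵇ-strip : ∀ d l → (suc (suc d) ∈ᵇ l) ≡ (suc d ∈ᵇ strip l)
∈ᵇ-strip d [] = refl
∈ᵇ-strip d (zero ∷ l) = ∈ᵇ-strip d l
∈ᵇ-strip d (suc zero ∷ l) = ∈ᵇ-strip d l
∈ᵇ-strip d (suc (suc y) ∷ l) = cong ((d ≡ᵇ y) ∨_) (∈ᵇ-strip d l)

0∈ᵇ-strip : ∀ l → (0 ∈ᵇ strip l) ≡ false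
0∈ᵇ-strip [] = refl
0∈ᵇ-strip (zero ∷ l) = 0∈ᵇ-strip l
0∈ᵇ-strip (suc zero ∷ l) = 0∈ᵇ-strip l
0∈ᵇ-strip (suc (suc y) ∷ l) = 0∈ᵇ-strip l

countBelow-strip : ∀ t y → Positive t → countBelow t (2 + y) ≡ 𝟙 (1 ∈ᵇ t) + countBelow (strip t) (suc y)
countBelow-strip t zero t⁺ rewrite 0∈ᵇ-positive t⁺ | 0∈ᵇ-strip t = sym (+-identityʳ _)
countBelow-strip t (suc y) t⁺ = begin
  countBelow t (2 + y) + 𝟙 (2 + y ∈ᵇ t)
    ≡⟨ cong₂ _+_ (countBelow-strip t y t⁺) (cong 𝟙 (∈ᵇ-strip y t)) ⟩
  𝟙 (1 ∈ᵇ t) + countBelow (strip t) (suc y) + 𝟙 (suc y ∈ᵇ strip t)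
    ≡⟨ +-assoc (𝟙 (1 ∈ᵇ t)) _ _ ⟩
  𝟙 (1 ∈ᵇ t) + countBelow (strip t) (2 + y) ∎

∈ᵇ-++⁺ˡ : ∀ {c} l {l'} → (c ∈ᵇ l) ≡ true → (c ∈ᵇ l ++ l') ≡ true
∈ᵇ-++⁺ˡ {c} (x ∷ l) c∈l with c ≡ᵇ x
... | true = refl
... | false = ∈ᵇ-++⁺ˡ l c∈l

strip-++ : ∀ l l' → strip (l ++ l') ≡ strip l ++ strip l'
strip-++ [] l' = refl
strip-++ (zero ∷ l) l' = strip-++ l l'
strip-++ (suc zero ∷ l) l' = strip-++ l l'
strip-++ (suc (suc y) ∷ l) l' = cong (suc y ∷_) (strip-++ l l')

-- Once a 1 has been read, every later letter ≥ 2 sees it as a smaller value.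
lsFrom-mask-strip : ∀ pre t → Positive pre → Positive t → (1 ∈ᵇ pre) ≡ true →
  lsFrom pre t ≡ trues (mask t) + lsFrom (strip pre) (strip t)
lsFrom-mask-strip pre [] _ _ _ = refl
lsFrom-mask-strip pre (suc zero ∷ t) pre⁺ (_ ∷ t⁺) 1∈pre = begin
  distinctBelow pre 1 + lsFrom (pre ++ [ 1 ]) t
    ≡⟨ cong₂ _+_ (trans (distinctBelow≡countBelow pre 1) (countBelow-1-positive pre⁺))
                 (lsFrom-mask-strip (pre ++ [ 1 ]) t (All.++⁺ pre⁺ (z<s ∷ [])) t⁺ (∈ᵇ-++⁺ˡ pre 1∈pre)) ⟩
  trues (mask t) + lsFrom (strip (pre ++ [ 1 ])) (strip t)
    ≡⟨ cong (λ u → trues (mask t) + lsFrom u (strip t)) (trans (strip-++ pre [ 1 ]) (++-identityʳ (strip pre))) ⟩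
  trues (mask t) + lsFrom (strip pre) (strip t) ∎
lsFrom-mask-strip pre (suc (suc y) ∷ t) pre⁺ (_ ∷ t⁺) 1∈pre = begin
  distinctBelow pre (2 + y) + lsFrom (pre ++ [ 2 + y ]) t
    ≡⟨ cong₂ _+_ seesOne
                 (lsFrom-mask-strip (pre ++ [ 2 + y ]) t (All.++⁺ pre⁺ (z<s ∷ [])) t⁺ (∈ᵇ-++⁺ˡ pre 1∈pre)) ⟩
  suc b + (trues (mask t) + lsFrom (strip (pre ++ [ 2 + y ])) (strip t))
    ≡⟨ cong (λ u → suc b + (trues (mask t) + lsFrom u (strip t))) (strip-++ pre [ 2 + y ]) ⟩
  suc b + (trues (mask t) + rest)
    ≡⟨ cong suc (x∙yz≈y∙xz b (trues (mask t)) rest) ⟩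
  suc (trues (mask t)) + (b + rest)
    ≡⟨ cong (λ c → suc (trues (mask t)) + (c + rest)) (distinctBelow≡countBelow (strip pre) (suc y)) ⟨
  suc (trues (mask t)) + (distinctBelow (strip pre) (suc y) + rest) ∎
  where
  b = countBelow (strip pre) (suc y)
  rest = lsFrom (strip pre ++ [ suc y ]) (strip t)
  seesOne : distinctBelow pre (2 + y) ≡ suc b
  seesOne = trans (distinctBelow≡countBelow pre (2 + y))
                  (trans (countBelow-strip pre y pre⁺) (cong (λ c → 𝟙 c + b) 1∈pre))

ls-1∷ : ∀ {t} → Positive t → ls (1 ∷ t) ≡ trues (mask t) + ls (strip t)
ls-1∷ {t} t⁺ = lsFrom-mask-strip [ 1 ] t (z<s ∷ []) t⁺ refl

hasFalse-mask : ∀ {t} → Positive t → hasFalse (mask t) ≡ (1 ∈ᵇ t)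
hasFalse-mask [] = refl
hasFalse-mask {suc zero ∷ t} _ = refl
hasFalse-mask {suc (suc y) ∷ t} (_ ∷ t⁺) = hasFalse-mask t⁺

-- A letter ≥ 2 sees the value 1 to its right iff a later position of the mask is false.
rs-mask-strip : ∀ {t} → Positive t → rs t ≡ truesBeforeFalse (mask t) + rs (strip t)
rs-mask-strip [] = refl
rs-mask-strip {suc zero ∷ t} (_ ∷ t⁺) =
  cong₂ _+_ (trans (distinctBelow≡countBelow t 1) (countBelow-1-positive t⁺)) (rs-mask-strip t⁺)
rs-mask-strip {suc (suc y) ∷ t} (_ ∷ t⁺) = begin
  distinctBelow t (2 + y) + rs t
    ≡⟨ cong₂ _+_ (trans (distinctBelow≡countBelow t (2 + y)) (countBelow-strip t y t⁺)) (rs-mask-strip t⁺) ⟩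
  (𝟙 (1 ∈ᵇ t) + countBelow (strip t) (suc y)) + (truesBeforeFalse (mask t) + rs (strip t))
    ≡⟨ interchange (𝟙 (1 ∈ᵇ t)) _ _ _ ⟩
  (𝟙 (1 ∈ᵇ t) + truesBeforeFalse (mask t)) + (countBelow (strip t) (suc y) + rs (strip t))
    ≡⟨ cong₂ (λ b c → (𝟙 b + truesBeforeFalse (mask t)) + (c + rs (strip t)))
             (sym (hasFalse-mask t⁺)) (sym (distinctBelow≡countBelow (strip t) (suc y))) ⟩
  (𝟙 (hasFalse (mask t)) + truesBeforeFalse (mask t)) + (distinctBelow (strip t) (suc y) + rs (strip t)) ∎

rs-1∷ : ∀ {t} → Positive t → rs (1 ∷ t) ≡ truesBeforeFalse (mask t) + rs (strip t)
rs-1∷ t⁺ = rs-mask-strip (z<s ∷ t⁺)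

-- Containment of 1(v+1)

Any-subwords⁻ : ∀ {P : Word → Set} w → Any P (subwords w) → ∃[ s ] s ⊆ w × P s
Any-subwords⁻ [] (here ps) = [] , [] , ps
Any-subwords⁻ (x ∷ w) any-s with Any.++⁻ (map (x ∷_) (subwords w)) any-s
... | inj₁ any-keep with s , s⊆w , ps ← Any-subwords⁻ w (Any.map⁻ any-keep) = x ∷ s , refl ∷ s⊆w , ps
... | inj₂ any-drop with s , s⊆w , ps ← Any-subwords⁻ w any-drop = s , x ∷ʳ s⊆w , ps

Any-subwords⁺ : ∀ {P : Word → Set} {s w} → s ⊆ w → P s → Any P (subwords w)
Any-subwords⁺ [] ps = here ps
Any-subwords⁺ (refl ∷ s⊆w) ps = Any.++⁺ˡ (Any.map⁺ (Any-subwords⁺ s⊆w ps))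
Any-subwords⁺ {w = x ∷ w} (_ ∷ʳ s⊆w) ps = Any.++⁺ʳ (map (x ∷_) (subwords w)) (Any-subwords⁺ s⊆w ps)

==w⇒≡ : ∀ u v → T (u ==w v) → u ≡ v
==w⇒≡ [] [] _ = refl
==w⇒≡ (x ∷ u) (y ∷ v) t with x ≡ᵇ y in x≡y
... | true = cong₂ _∷_ (≡ᵇ≡true⇒≡ x≡y) (==w⇒≡ u v t)

==w-refl : ∀ u → T (u ==w u)
==w-refl [] = _
==w-refl (x ∷ u) rewrite ≡ᵇ-refl x = ==w-refl u

contains⇒ : ∀ w v → T (contains w v) → ∃[ s ] s ⊆ w × std s ≡ v
contains⇒ w v c with s , s⊆w , eq ← Any-subwords⁻ w (Any.any⁻ _ (subwords w) c) = s , s⊆w , ==w⇒≡ (std s) v eq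

⊆⇒contains : ∀ {s w v} → s ⊆ w → std s ≡ v → T (contains w v)
⊆⇒contains {s} s⊆w refl = Any.any⁺ _ (Any-subwords⁺ s⊆w (==w-refl (std s)))

Positive-strip : ∀ t → Positive (strip t)
Positive-strip [] = []
Positive-strip (zero ∷ t) = Positive-strip t
Positive-strip (suc zero ∷ t) = Positive-strip t
Positive-strip (suc (suc y) ∷ t) = z<s ∷ Positive-strip t

⊆-strip⁻ : ∀ {s} t → s ⊆ strip t → map suc s ⊆ t
⊆-strip⁻ [] [] = []
⊆-strip⁻ (zero ∷ t) s⊆ = zero ∷ʳ ⊆-strip⁻ t s⊆
⊆-strip⁻ (suc zero ∷ t) s⊆ = 1 ∷ʳ ⊆-strip⁻ t s⊆
⊆-strip⁻ (suc (suc y) ∷ t) (refl ∷ s⊆) = refl ∷ ⊆-strip⁻ t s⊆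
⊆-strip⁻ (suc (suc y) ∷ t) (_ ∷ʳ s⊆) = _ ∷ʳ ⊆-strip⁻ t s⊆

⊆-strip : ∀ {s t} → s ⊆ t → All (2 ≤_) s → map pred s ⊆ strip t
⊆-strip [] [] = []
⊆-strip (refl ∷ s⊆) (s≤s (s≤s _) ∷ s≥2) = refl ∷ ⊆-strip s⊆ s≥2
⊆-strip (zero ∷ʳ s⊆) s≥2 = ⊆-strip s⊆ s≥2
⊆-strip (suc zero ∷ʳ s⊆) s≥2 = ⊆-strip s⊆ s≥2
⊆-strip (suc (suc y) ∷ʳ s⊆) s≥2 = suc y ∷ʳ ⊆-strip s⊆ s≥2

countBelow-∷-≥ : ∀ a l x → x ≤ a → countBelow (a ∷ l) x ≡ countBelow l x
countBelow-∷-≥ a l zero _ = refl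
countBelow-∷-≥ a l (suc x) x<a =
  cong₂ _+_ (countBelow-∷-≥ a l x (<⇒≤ x<a)) (cong (λ b → 𝟙 (b ∨ (x ∈ᵇ l))) (≢⇒≡ᵇ≡false (<⇒≢ x<a)))

countBelow-∷-new : ∀ a l x → a < x → (a ∈ᵇ l) ≡ false → countBelow (a ∷ l) x ≡ suc (countBelow l x)
countBelow-∷-new a l (suc x) (s≤s a≤x) a∉l with m≤n⇒m<n∨m≡n a≤x
... | inj₁ a<x =
  cong₂ _+_ (countBelow-∷-new a l x a<x a∉l)
            (cong (λ b → 𝟙 (b ∨ (x ∈ᵇ l))) (≢⇒≡ᵇ≡false (≢-sym (<⇒≢ a<x))))
... | inj₂ refl = begin
  countBelow (a ∷ l) a + 𝟙 ((a ≡ᵇ a) ∨ (a ∈ᵇ l))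
    ≡⟨ cong₂ _+_ (countBelow-∷-≥ a l a ≤-refl) (cong (λ b → 𝟙 (b ∨ (a ∈ᵇ l))) (≡ᵇ-refl a)) ⟩
  countBelow l a + 1
    ≡⟨ +-comm (countBelow l a) 1 ⟩
  suc (countBelow l a)
    ≡⟨ cong suc (+-identityʳ (countBelow l a)) ⟨
  suc (countBelow l a + 𝟙 false)
    ≡⟨ cong (λ b → suc (countBelow l a + 𝟙 b)) a∉l ⟨
  suc (countBelow l (suc a)) ∎

countBelow-positive : ∀ c l x → (c ∈ᵇ l) ≡ true → c < x → 0 < countBelow l x
countBelow-positive c l (suc x) c∈l (s≤s c≤x) with m≤n⇒m<n∨m≡n c≤x
... | inj₁ c<x = <-≤-trans (countBelow-positive c l x c∈l c<x) (m≤m+n (countBelow l x) _)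
... | inj₂ refl rewrite c∈l = subst (0 <_) (+-comm 1 (countBelow l c)) z<s

𝟙-∨ʳ : ∀ b c → 𝟙 c ≤ 𝟙 (b ∨ c)
𝟙-∨ʳ true true = ≤-refl
𝟙-∨ʳ true false = z≤n
𝟙-∨ʳ false c = ≤-refl

countBelow-∷-mono : ∀ a l x → countBelow l x ≤ countBelow (a ∷ l) x
countBelow-∷-mono a l zero = z≤n
countBelow-∷-mono a l (suc x) = +-mono-≤ (countBelow-∷-mono a l x) (𝟙-∨ʳ (x ≡ᵇ a) (x ∈ᵇ l))

countBelow≡0⇒All≥ : ∀ a l → countBelow l a ≡ 0 → All (a ≤_) l
countBelow≡0⇒All≥ a [] _ = []
countBelow≡0⇒All≥ a (x ∷ l) none =
  a≤x ∷ countBelow≡0⇒All≥ a l (n≤0⇒n≡0 (subst (countBelow l a ≤_) none (countBelow-∷-mono x l a)))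
  where
  a≤x : a ≤ x
  a≤x with x <? a
  ... | yes x<a = ⊥-elim (<-irrefl (sym none) (countBelow-positive x (x ∷ l) a (cong (_∨ (x ∈ᵇ l)) (≡ᵇ-refl x)) x<a))
  ... | no x≮a = ≮⇒≥ x≮a

∉ᵇ-All> : ∀ a l → All (a <_) l → (a ∈ᵇ l) ≡ false
∉ᵇ-All> a [] [] = refl
∉ᵇ-All> a (x ∷ l) (a<x ∷ a<l) = trans (cong (_∨ (a ∈ᵇ l)) (≢⇒≡ᵇ≡false (<⇒≢ a<x))) (∉ᵇ-All> a l a<l)

std-map-suc : ∀ l → std (map suc l) ≡ std l
std-map-suc l = begin
  map (λ x → suc (distinctBelow (map suc l) x)) (map suc l)  ≡⟨ map-∘ l ⟨
  map (λ x → suc (distinctBelow (map suc l) (suc x))) l      ≡⟨ map-cong shift l ⟩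
  std l                                                      ∎
  where
  shift : ∀ x → suc (distinctBelow (map suc l) (suc x)) ≡ suc (distinctBelow l x)
  shift x = cong suc (begin
    distinctBelow (map suc l) (suc x)  ≡⟨ distinctBelow≡countBelow (map suc l) (suc x) ⟩
    countBelow (map suc l) (suc x)     ≡⟨ countBelow-map-suc l x ⟩
    countBelow l x                     ≡⟨ distinctBelow≡countBelow l x ⟨
    distinctBelow l x                  ∎)

map-suc-pred : ∀ {l} → Positive l → map suc (map pred l) ≡ l
map-suc-pred [] = refl
map-suc-pred {suc x ∷ l} (_ ∷ l⁺) = cong (suc x ∷_) (map-suc-pred l⁺)

std-map-pred : ∀ {l} → Positive l → std (map pred l) ≡ std l
std-map-pred {l} l⁺ = trans (sym (std-map-suc (map pred l))) (cong std (map-suc-pred l⁺))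

std-bar : ∀ {s} → Positive s → std (bar s) ≡ bar (std s)
std-bar {s} s⁺ = cong₂ _∷_
  (cong suc (trans (distinctBelow≡countBelow (bar s) 1) (cong 𝟙 (0∈ᵇ-map-suc s))))
  (trans (sym (map-∘ s)) (trans (map-cong-local (All.map shift s⁺)) (map-∘ s)))
  where
  shift : ∀ {x} → 0 < x → suc (distinctBelow (bar s) (suc x)) ≡ suc (suc (distinctBelow s x))
  shift {suc x} _ = cong suc (begin
    distinctBelow (bar s) (2 + x)          ≡⟨ distinctBelow≡countBelow (bar s) (2 + x) ⟩
    countBelow (1 ∷ map suc s) (2 + x)     ≡⟨ countBelow-map-suc (0 ∷ s) (suc x) ⟩
    countBelow (0 ∷ s) (suc x)             ≡⟨ countBelow-∷-new 0 s (suc x) z<s (0∈ᵇ-positive s⁺) ⟩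
    suc (countBelow s (suc x))             ≡⟨ cong suc (distinctBelow≡countBelow s (suc x)) ⟨
    suc (distinctBelow s (suc x))          ∎)

-- The first letter a of an occurrence of 1(v+1) has no smaller letter after it, and
-- no later letter equals a, because every later letter receives a standardized value ≥ 2.
std≡bar⁻¹ : ∀ {a s v} → Positive v → std (a ∷ s) ≡ bar v → All (a <_) s × std s ≡ v
std≡bar⁻¹ {a} {s} {v} v⁺ std≡bar = a<s , map-injective suc-injective stdTail
  where
  noneBelow : distinctBelow (a ∷ s) a ≡ 0
  noneBelow = suc-injective (proj₁ (∷-injective std≡bar))
  tail≡ : map (λ x → suc (distinctBelow (a ∷ s) x)) s ≡ map suc v
  tail≡ = proj₂ (∷-injective std≡bar)
  a≤s : All (a ≤_) s
  a≤s = All.tail (countBelow≡0⇒All≥ a (a ∷ s) (trans (sym (distinctBelow≡countBelow (a ∷ s) a)) noneBelow))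
  tail≥2 : All (λ x → 2 ≤ suc (distinctBelow (a ∷ s) x)) s
  tail≥2 = All.map⁻ (subst (All (2 ≤_)) (sym tail≡) (All.map⁺ (All.map s≤s v⁺)))
  a<x : ∀ {x} → a ≤ x × 2 ≤ suc (distinctBelow (a ∷ s) x) → a < x
  a<x (a≤x , 2≤) = ≤∧≢⇒< a≤x (λ { refl → <-irrefl refl (subst (λ k → 1 < suc k) noneBelow 2≤) })
  a<s : All (a <_) s
  a<s = All.map a<x (All.zip (a≤s , tail≥2))
  shift : ∀ {x} → a < x → suc (suc (distinctBelow s x)) ≡ suc (distinctBelow (a ∷ s) x)
  shift {x} a<x = cong suc (sym (begin
    distinctBelow (a ∷ s) x    ≡⟨ distinctBelow≡countBelow (a ∷ s) x ⟩
    countBelow (a ∷ s) x       ≡⟨ countBelow-∷-new a s x a<x (∉ᵇ-All> a s a<s) ⟩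
    suc (countBelow s x)       ≡⟨ cong suc (distinctBelow≡countBelow s x) ⟨
    suc (distinctBelow s x)    ∎))
  stdTail : map suc (std s) ≡ map suc v
  stdTail = trans (sym (map-∘ s)) (trans (map-cong-local (All.map shift a<s)) tail≡)

contains-bar : ∀ {t v} → Positive t → Positive v → contains (1 ∷ t) (bar v) ≡ contains (strip t) v
contains-bar {t} {v} t⁺ v⁺ = T-ext fromBar toBar
  where
  toBar : T (contains (strip t) v) → T (contains (1 ∷ t) (bar v))
  toBar c with s , s⊆ , refl ← contains⇒ (strip t) v c =
    ⊆⇒contains (refl ∷ ⊆-strip⁻ t s⊆) (std-bar (All-resp-⊆ s⊆ (Positive-strip t)))
  fromBar : T (contains (1 ∷ t) (bar v)) → T (contains (strip t) v)
  fromBar c with contains⇒ (1 ∷ t) (bar v) c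
  ... | a ∷ s , as⊆ , std≡bar with a<s , std≡v ← std≡bar⁻¹ v⁺ std≡bar =
    ⊆⇒contains (⊆-strip (∷⁻ as⊆) s≥2) (trans (std-map-pred (All.map (≤-trans (s≤s z≤n)) s≥2)) std≡v)
    where
    s≥2 : All (2 ≤_) s
    s≥2 with 0<a ∷ _ ← All-resp-⊆ as⊆ (z<s ∷ t⁺) = All.map (≤-trans (s≤s 0<a)) a<s

avoids-bar : ∀ {t v} → Positive t → Positive v → avoids (1 ∷ t) (bar v) ≡ avoids (strip t) v
avoids-bar t⁺ v⁺ = cong (λ b → if b then false else true) (contains-bar t⁺ v⁺)

-- The generating functions of R_n(1(v+1))

-- Imported only here: Data.Integer's +_ makes the sections (x +_) used above ambiguous.
open import Data.Integer using (+_; _⊖_) renaming (_-_ to _-ℤ_)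
open import Data.Integer.Properties using ([+m]-[+n]≡m⊖n; [1+m]⊖[1+n]≡m⊖n; +-cancelˡ-⊖; ⊖-≥)

Positive-RGF : ∀ mx v → T (isRGFFrom mx v) → Positive v
Positive-RGF mx [] _ = []
Positive-RGF mx (zero ∷ v) ()
Positive-RGF mx (suc x ∷ v) rgf = z<s ∷ Positive-RGF (mx ⊔ suc x) v (proj₂ (Equivalence.to T-∧ rgf))

genFun-bar : ∀ (st : Word → ℕ) (e : List Bool → ℕ) n v m → Positive v →
  (∀ {t} → Positive t → st (1 ∷ t) ≡ e (mask t) + st (strip t)) →
  genFun st (suc n) (bar v) m ≡ sumBits n (λ p → qpow* (e p) (genFun st (trues p) v) m)
genFun-bar st e n v m v⁺ st-1∷ = begin
  genFun st (suc n) (bar v) m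
    ≡⟨ genFun≡sumRGF st (suc n) (bar v) m ⟩
  sumRGF n 1 (λ t → 𝟙 (avoids (1 ∷ t) (bar v)) * 𝟙 (st (1 ∷ t) ≡ᵇ m)) + 0
    ≡⟨ +-identityʳ _ ⟩
  sumRGF n 1 (λ t → 𝟙 (avoids (1 ∷ t) (bar v)) * 𝟙 (st (1 ∷ t) ≡ᵇ m))
    ≡⟨ sumRGF-cong n 1 (λ t t⁺ → cong₂ (λ a s → 𝟙 a * 𝟙 (s ≡ᵇ m)) (avoids-bar t⁺ v⁺) (st-1∷ t⁺)) ⟩
  sumRGF n 1 (λ t → 𝟙 (avoids (strip t) v) * 𝟙 (e (mask t) + st (strip t) ≡ᵇ m))
    ≡⟨ sumRGF-mask-strip n 0 (λ p u → 𝟙 (avoids u v) * 𝟙 (e p + st u ≡ᵇ m)) ⟩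
  sumBits n (λ p → sumRGF (trues p) 0 (λ u → 𝟙 (avoids u v) * 𝟙 (e p + st u ≡ᵇ m)))
    ≡⟨ sumBits-cong n (λ p → genFun-shift st (trues p) v (e p) m) ⟩
  sumBits n (λ p → qpow* (e p) (genFun st (trues p) v) m) ∎

Σ<≡sum< : ∀ n (f : ℕ → Poly) m → Σ< n f m ≡ sum< n (λ j → f j m)
Σ<≡sum< zero f m = refl
Σ<≡sum< (suc n) f m = trans (cong (_+ f n m) (Σ<≡sum< n f m)) (sym (sum<-suc n (λ j → f j m)))

binomℤ-⊖1 : ∀ a k → binomℤ ((a + k) ⊖ 1) k ≡ multichoose a k
binomℤ-⊖1 zero zero = refl
binomℤ-⊖1 zero (suc k) =
  trans (cong (λ z → binomℤ z (suc k)) (trans ([1+m]⊖[1+n]≡m⊖n k 0) (⊖-≥ z≤n))) (k>n⇒nCk≡0 {k} {suc k} ≤-refl)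
binomℤ-⊖1 (suc a) k = cong (λ z → binomℤ z k) (trans ([1+m]⊖[1+n]≡m⊖n (a + k) 0) (⊖-≥ z≤n))

binomℤ≡multichoose : ∀ n j k → j ≤ n → binomℤ (+ (suc n + k) -ℤ + (j + 2)) k ≡ multichoose (n ∸ j) k
binomℤ≡multichoose n j k j≤n = trans (cong (λ z → binomℤ z k) index) (binomℤ-⊖1 (n ∸ j) k)
  where
  a = n ∸ j
  index : + (suc n + k) -ℤ + (j + 2) ≡ (a + k) ⊖ 1
  index = begin
    + (suc n + k) -ℤ + (j + 2)        ≡⟨ [+m]-[+n]≡m⊖n (suc n + k) (j + 2) ⟩
    (suc n + k) ⊖ (j + 2)             ≡⟨ cong (λ z → (suc z + k) ⊖ (j + 2)) (m∸n+n≡m j≤n) ⟨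
    (suc (a + j) + k) ⊖ (j + 2)       ≡⟨ cong (_⊖ (j + 2)) (rearrange a j k) ⟩
    (j + suc (a + k)) ⊖ (j + 2)       ≡⟨ +-cancelˡ-⊖ j (suc (a + k)) 2 ⟩
    suc (a + k) ⊖ 2                   ≡⟨ [1+m]⊖[1+n]≡m⊖n (a + k) 1 ⟩
    (a + k) ⊖ 1                       ∎
    where
    rearrange : ∀ a j k → suc (a + j) + k ≡ j + suc (a + k)
    rearrange = solve 3 (λ a j k → (con 1 :+ (a :+ j)) :+ k := j :+ (con 1 :+ (a :+ k))) refl

LS-bar : ∀ {v} → Positive v → ∀ n m →
  LS (suc n) (bar v) m ≡ Σ< (suc n) (λ j → scale (n C j) (qpow* j (LS j v))) m
LS-bar {v} v⁺ n m = begin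
  LS (suc n) (bar v) m                                   ≡⟨ genFun-bar ls trues n v m v⁺ ls-1∷ ⟩
  sumBits n (λ p → qpow* (trues p) (LS (trues p) v) m)   ≡⟨ sumBits-trues n (λ j → qpow* j (LS j v) m) ⟩
  sum< (suc n) (λ j → (n C j) * qpow* j (LS j v) m)      ≡⟨ Σ<≡sum< (suc n) _ m ⟨
  Σ< (suc n) (λ j → scale (n C j) (qpow* j (LS j v))) m  ∎

RS-bar : ∀ {v} → Positive v → ∀ n m →
  RS (suc n) (bar v) m
    ≡ Σ< (suc n) (λ j → Σ≤ j (λ k → scale (binomℤ (+ (suc n + k) -ℤ + (j + 2)) k) (qpow* k (RS j v)))) m
RS-bar {v} v⁺ n m = begin
  RS (suc n) (bar v) m
    ≡⟨ genFun-bar rs truesBeforeFalse n v m v⁺ rs-1∷ ⟩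
  sumBits n (λ p → qpow* (truesBeforeFalse p) (RS (trues p) v) m)
    ≡⟨ sumBits-trues-truesBeforeFalse n (λ j k → qpow* k (RS j v) m) ⟩
  sum< (suc n) (λ j → sum< (suc j) (λ k → multichoose (n ∸ j) k * qpow* k (RS j v) m))
    ≡⟨ sum<-cong (suc n) (λ j j≤n → sum<-cong (suc j) (λ k _ →
         cong (_* qpow* k (RS j v) m) (binomℤ≡multichoose n j k (≤-pred j≤n)))) ⟨
  sum< (suc n) (λ j → sum< (suc j) (λ k → c j k * qpow* k (RS j v) m))
    ≡⟨ sum<-cong (suc n) (λ j _ → Σ<≡sum< (suc j) (λ k → scale (c j k) (qpow* k (RS j v))) m) ⟨
  sum< (suc n) (λ j → Σ≤ j (λ k → scale (c j k) (qpow* k (RS j v))) m)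
    ≡⟨ Σ<≡sum< (suc n) _ m ⟨
  Σ< (suc n) (λ j → Σ≤ j (λ k → scale (c j k) (qpow* k (RS j v)))) m ∎
  where
  c : ℕ → ℕ → ℕ
  c j k = binomℤ (+ (suc n + k) -ℤ + (j + 2)) k

theorem4p1 : (v : Word) → T (isRGF v) → (n : ℕ) → n ≥ 1 →
    ((m : ℕ) → LS n (bar v) m
       ≡ Σ< n (λ j → scale ((n ∸ 1) C j) (qpow* j (LS j v))) m)
    × ((m : ℕ) → RS n (bar v) m
       ≡ Σ< n (λ j → Σ≤ j (λ k → scale (binomℤ ((+ (n + k)) -ℤ (+ (j + 2))) k) (qpow* k (RS j v)))) m)
theorem4p1 v v-rgf (suc n) _ = LS-bar v⁺ n , RS-bar v⁺ n
  where
  v⁺ : Positive v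
  v⁺ = Positive-RGF 0 v v-rgf
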